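{- Let $\vec G=(V,\vec E)$ be a directed acyclic graph, $S,T\subseteq V$ disjoint with $|S|=|T|=k$, $v_1,\dots,v_n$ a topological ordering of $V$ (i.e., $(v_i,v_j)\notin\vec E$ whenever $i\ge j$), $G=(V,E)$ the undirected graph obtained by ignoring orientations, and $l(e)=j-i$ for $e=\{v_i,v_j\}\in E$ with $i<j$. Suppose $\vec G$ has at least one disjoint directed $S$--$T$ path. Then $P\subseteq E$ is a shortest disjoint $S$--$T$ path of $G$ (with respect to $l$) if and only if $\vec P$ is a disjoint directed $S$--$T$ path of $\vec G$.
   Context: Write $S=\{s_1,\dots,s_k\}$, $T=\{t_1,\dots,t_k\}$. An (undirected) disjoint $S$--$T$ path of $G$ is an edge set $P$ that is the union of $k$ pairwise vertex-disjoint paths $P_1,\dots,P_k$ such that, for some permutation $\sigma$ of $\{1,\dots,k\}$, $P_i$ joins $s_i$ and $t_{\sigma(i)}$; its length is $l(P)=\sum_{e\in P}l(e)$, and it is shortest if it minimizes length among all disjoint $S$--$T$ paths of $G$. A disjoint directed $S$--$T$ path of $\vec G$ is defined analogously with directed paths from $s_i$ to $t_{\sigma(i)}$. $\vec P$ denotes the set of arcs of $\vec G$ corresponding to edges of $P$. -}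

module Defs where

open import Data.Nat using (ℕ; zero; suc; _+_; _∸_; _<_; _<ᵇ_)
open import Data.Fin using (Fin; zero; suc; toℕ; inject₁; fromℕ)
open import Data.Fin.Permutation using (Permutation′; _⟨$⟩ʳ_)
open import Data.Bool using (Bool; true; false; _∧_; if_then_else_)
open import Data.Product using (Σ; ∃; _×_; _,_)
open import Data.Sum using (_⊎_)
open import Relation.Binary.PropositionalEquality using (_≡_; _≢_)
open import Function.Definitions using (Injective)
open import Level using (0ℓ)

-- Vertices are Fin n; the vertex v_{i+1} of the topological ordering is `i`.
-- A relation on vertices (arcs / edges).
Rel : ℕ → Set₁
Rel n = Fin n → Fin n → Set

Und : ∀ {n} → Rel n → Rel n
Und A a b = A a b ⊎ A b a

sumFin : ∀ {n} → (Fin n → ℕ) → ℕ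
sumFin {zero}  f = 0
sumFin {suc n} f = f zero + sumFin (λ i → f (suc i))

-- An undirected edge set of G is represented by a symmetric Bool-valued
-- relation P (P a b ≡ P b a ≡ true  means the edge {a,b} is in the set).
-- Length l(P) = Σ_{ {v_i,v_j} ∈ P, i<j } (j - i).
len : ∀ {n} → (Fin n → Fin n → Bool) → ℕ
len P = sumFin λ i → sumFin λ j →
  if (P i j ∧ (toℕ i <ᵇ toℕ j)) then toℕ j ∸ toℕ i else 0

-- A system of k paths w_i (i : Fin k) in the relation R (R = Und A for
-- undirected paths, R = A for directed paths), path i going from S i to
-- T (σ i), each path having pairwise distinct vertices, and different
-- paths being vertex-disjoint.
record PathSystem {n k : ℕ} (R : Rel n) (S T : Fin k → Fin n) : Set where
  field
    σ     : Permutation′ k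
    len′  : Fin k → ℕ
    w     : (i : Fin k) → Fin (suc (len′ i)) → Fin n
    simple : ∀ i → Injective _≡_ _≡_ (w i)
    start : ∀ i → w i zero ≡ S i
    end   : ∀ i → w i (fromℕ (len′ i)) ≡ T (σ ⟨$⟩ʳ i)
    step  : ∀ i (r : Fin (len′ i)) → R (w i (inject₁ r)) (w i (suc r))
    disj  : ∀ i j → i ≢ j → ∀ r r′ → w i r ≢ w j r′

open PathSystem public

Consec : ∀ {n k} {R : Rel n} {S T : Fin k → Fin n} → PathSystem R S T → Rel n
Consec ps a b = ∃ λ i → ∃ λ (r : Fin (len′ ps i)) →
  (w ps i (inject₁ r) ≡ a) × (w ps i (suc r) ≡ b)

UEdges : ∀ {n k} {R : Rel n} {S T : Fin k → Fin n} → PathSystem R S T → Rel n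
UEdges ps a b = Consec ps a b ⊎ Consec ps b a

_⇔_ : Set → Set → Set
X ⇔ Y = (X → Y) × (Y → X)

IsDisjPath : ∀ {n k} (A : Rel n) (S T : Fin k → Fin n) → (Fin n → Fin n → Bool) → Set
IsDisjPath A S T P = Σ (PathSystem (Und A) S T) λ ps →
  ∀ a b → (P a b ≡ true) ⇔ UEdges ps a b

IsShortestDisjPath : ∀ {n k} (A : Rel n) (S T : Fin k → Fin n) → (Fin n → Fin n → Bool) → Set
IsShortestDisjPath A S T P =
  IsDisjPath A S T P × (∀ Q → IsDisjPath A S T Q → len P Data.Nat.≤ len Q)

IsDisjDirPath : ∀ {n k} (A : Rel n) (S T : Fin k → Fin n) → Rel n → Set
IsDisjDirPath A S T D = Σ (PathSystem A S T) λ ps →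
  ∀ a b → D a b ⇔ Consec ps a b

Arcs : ∀ {n} → Rel n → (Fin n → Fin n → Bool) → Rel n
Arcs A P a b = A a b × (P a b ≡ true)

-- A step v_i v_j of an undirected walk has length |j - i| = (j - i) + 2 (i ∸ j),
-- so telescoping along each path and summing over the k paths gives, for
-- every disjoint S–T path Q of G with vertex sets S and T read as numbers,
--   l(Q) + ΣS = ΣT + 2 · (total length of the steps of Q walked backwards).
-- Hence l(Q) ≥ ΣT − ΣS, with equality exactly when every step goes forward
-- in the topological order, i.e. when every step is an arc of the digraph.
-- A directed S–T path exists, so the bound is attained and the shortest
-- disjoint S–T paths are exactly the directed ones.
module Submission where

open import Defs
open import Algebra.Properties.CommutativeMonoid.Sum as ℕSum using ()
open import Data.Bool using (Bool; true; false; _∧_; if_then_else_)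
open import Data.Bool.Properties using (T-≡)
open import Data.Empty using (⊥-elim)
open import Data.Fin using (Fin; zero; suc; toℕ; inject₁; fromℕ)
open import Data.Fin.Permutation using (Permutation′; _⟨$⟩ʳ_)
open import Data.Fin.Properties using (any?; toℕ-inject₁; toℕ-injective; inject₁-injective; suc-injective) renaming (_≟_ to _≟ᶠ_)
open import Data.Nat using (ℕ; zero; suc; _+_; _*_; _∸_; _<_; _≤_; _<ᵇ_; ∣_-_∣)
open import Data.Nat.Properties
  using ( +-0-commutativeMonoid; +-identityʳ; +-comm; +-assoc; _<?_; <⇒≤; ≮⇒≥; <-asym
        ; ≤-total; ≤-reflexive; ≤∧≢⇒<; m≤n⇒m∸n≡0; m∸n≡0⇒m≤n; m∸n+n≡m; m≤n⇒∣m-n∣≡n∸m; ∣-∣-comm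
        ; 1+n≢n; m+n≡0⇒m≡0; m+n≡0⇒n≡0; m≤m+n; n≤0⇒n≡0; +-cancelˡ-≤; +-cancelʳ-≤; +-monoˡ-≤; <⇒<ᵇ; <ᵇ⇒< )
open import Data.Product using (Σ; ∃₂; _×_; _,_; proj₁; proj₂; uncurry)
open import Data.Product.Properties using (≡-dec)
open import Data.Sum using (_⊎_; inj₁; inj₂)
open import Function using (_∘_)
open import Function.Bundles using (Equivalence)
open import Function.Definitions using (Injective)
open import Relation.Nullary using (Dec; yes; no; ¬_; does)
open import Relation.Nullary.Decidable using (dec-true; dec-false; _⊎-dec_; _×-dec_)
open import Relation.Binary.PropositionalEquality
open import Data.Nat.Solver using (module +-*-Solver)
open +-*-Solver using (solve; _:+_; _:*_; _:=_; con)

private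
  variable
    n k : ℕ

module ℕΣ = ℕSum +-0-commutativeMonoid

sumFin≗sum : (f : Fin n → ℕ) → sumFin f ≡ ℕΣ.sum f
sumFin≗sum {zero}  f = refl
sumFin≗sum {suc n} f = cong (f zero +_) (sumFin≗sum (f ∘ suc))

sumFin-cong : {f g : Fin n → ℕ} → (∀ i → f i ≡ g i) → sumFin f ≡ sumFin g
sumFin-cong {zero}  f≗g = refl
sumFin-cong {suc n} f≗g = cong₂ _+_ (f≗g zero) (sumFin-cong (f≗g ∘ suc))

sumFin-distrib-+ : (f g : Fin n → ℕ) → sumFin (λ i → f i + g i) ≡ sumFin f + sumFin g
sumFin-distrib-+ f g = begin
  sumFin (λ i → f i + g i)    ≡⟨ sumFin≗sum (λ i → f i + g i) ⟩
  ℕΣ.sum (λ i → f i + g i)    ≡⟨ ℕΣ.∑-distrib-+ f g ⟩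
  ℕΣ.sum f + ℕΣ.sum g         ≡⟨ sym (cong₂ _+_ (sumFin≗sum f) (sumFin≗sum g)) ⟩
  sumFin f + sumFin g         ∎
  where open ≡-Reasoning

sumFin-comm : ∀ {m} (f : Fin m → Fin n → ℕ) →
  sumFin (λ i → sumFin (f i)) ≡ sumFin (λ j → sumFin (λ i → f i j))
sumFin-comm f = begin
  sumFin (λ i → sumFin (f i))              ≡⟨ sumFin²≗sum² f ⟩
  ℕΣ.sum (λ i → ℕΣ.sum (f i))              ≡⟨ ℕΣ.∑-comm f ⟩
  ℕΣ.sum (λ j → ℕΣ.sum (λ i → f i j))      ≡⟨ sym (sumFin²≗sum² (λ j i → f i j)) ⟩
  sumFin (λ j → sumFin (λ i → f i j))      ∎
  where
  open ≡-Reasoning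
  sumFin²≗sum² : ∀ {a b} (g : Fin a → Fin b → ℕ) →
    sumFin (λ i → sumFin (g i)) ≡ ℕΣ.sum (λ i → ℕΣ.sum (g i))
  sumFin²≗sum² g = trans (sumFin-cong (sumFin≗sum ∘ g)) (sumFin≗sum (λ i → ℕΣ.sum (g i)))

sumFin-permute : (f : Fin k → ℕ) (π : Permutation′ k) → sumFin (f ∘ (π ⟨$⟩ʳ_)) ≡ sumFin f
sumFin-permute f π =
  trans (sumFin≗sum (f ∘ (π ⟨$⟩ʳ_))) (trans (sym (ℕΣ.sum-permute f π)) (sym (sumFin≗sum f)))

sumFin-zero : {f : Fin n → ℕ} → (∀ i → f i ≡ 0) → sumFin f ≡ 0
sumFin-zero {zero}  f≗0 = refl
sumFin-zero {suc n} f≗0 = cong₂ _+_ (f≗0 zero) (sumFin-zero (f≗0 ∘ suc))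

sumFin≡0⇒≡0 : (f : Fin n → ℕ) → sumFin f ≡ 0 → ∀ i → f i ≡ 0
sumFin≡0⇒≡0 f Σf≡0 zero    = m+n≡0⇒m≡0 (f zero) Σf≡0
sumFin≡0⇒≡0 f Σf≡0 (suc i) = sumFin≡0⇒≡0 (f ∘ suc) (m+n≡0⇒n≡0 (f zero) Σf≡0) i

sumFin-point : (x : Fin n) (f : Fin n → ℕ) → (∀ i → i ≢ x → f i ≡ 0) → sumFin f ≡ f x
sumFin-point zero    f off = trans (cong (f zero +_) (sumFin-zero λ i → off (suc i) λ ())) (+-identityʳ _)
sumFin-point (suc x) f off =
  cong₂ _+_ (off zero λ ()) (sumFin-point x (f ∘ suc) λ i i≢x → off (suc i) (i≢x ∘ suc-injective))

if-does-yes : ∀ {X : Set} (d : Dec X) {a b : ℕ} → X → (if does d then a else b) ≡ a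
if-does-yes d x = cong (λ c → if c then _ else _) (dec-true d x)

if-does-no : ∀ {X : Set} (d : Dec X) {a b : ℕ} → ¬ X → (if does d then a else b) ≡ b
if-does-no d ¬x = cong (λ c → if c then _ else _) (dec-false d ¬x)

Σ² : (Fin n → Fin n → ℕ) → ℕ
Σ² h = sumFin λ a → sumFin λ b → h a b

_≟²_ : (p q : Fin n × Fin n) → Dec (p ≡ q)
_≟²_ = ≡-dec _≟ᶠ_ _≟ᶠ_

Σ²-point : (p : Fin n × Fin n) (f : Fin n → Fin n → ℕ) →
  Σ² (λ a b → if does (p ≟² (a , b)) then f a b else 0) ≡ uncurry f p
Σ²-point (x , y) f = begin
  Σ² (λ a b → δ a b (f a b))        ≡⟨ sumFin-point x _ off-row ⟩
  sumFin (λ b → δ x b (f x b))      ≡⟨ sumFin-point y _ off-column ⟩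
  δ x y (f x y)                     ≡⟨ if-does-yes ((x , y) ≟² (x , y)) refl ⟩
  f x y                             ∎
  where
  open ≡-Reasoning
  δ : Fin _ → Fin _ → ℕ → ℕ
  δ a b c = if does ((x , y) ≟² (a , b)) then c else 0
  off-row : ∀ a → a ≢ x → sumFin (λ b → δ a b (f a b)) ≡ 0
  off-row a a≢x = sumFin-zero λ b → if-does-no ((x , y) ≟² (a , b)) (a≢x ∘ sym ∘ cong proj₁)
  off-column : ∀ b → b ≢ y → δ x b (f x b) ≡ 0
  off-column b b≢y = if-does-no ((x , y) ≟² (x , b)) (b≢y ∘ sym ∘ cong proj₂)

module _ {L : Fin k → ℕ} (e : (i : Fin k) → Fin (L i) → Fin n × Fin n)
         (e-injective : ∀ i → Injective _≡_ _≡_ (e i))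
         (e-disjoint : ∀ i j r s → e i r ≡ e j s → i ≡ j) where

  private
    mass : (i : Fin k) (r : Fin (L i)) (f : Fin n → Fin n → ℕ) (a b : Fin n) → ℕ
    mass i r f a b = if does (e i r ≟² (a , b)) then f a b else 0

    hits? : ∀ p → Dec (∃₂ λ i r → e i r ≡ p)
    hits? p = any? λ i → any? λ r → e i r ≟² p

    mass-total : (f : Fin n → Fin n → ℕ) (a b : Fin n) →
      sumFin (λ i → sumFin (λ r → mass i r f a b)) ≡
      (if does (hits? (a , b)) then f a b else 0)
    mass-total f a b with hits? (a , b)
    ... | no miss = sumFin-zero λ i → sumFin-zero λ r →
          if-does-no (e i r ≟² (a , b)) λ eq → miss (i , r , eq)
    ... | yes (i₀ , r₀ , eq₀) =
          trans (sumFin-point i₀ _ λ i i≢i₀ → sumFin-zero λ r →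
                   if-does-no (e i r ≟² (a , b)) λ eq → i≢i₀ (e-disjoint i i₀ r r₀ (trans eq (sym eq₀))))
          (trans (sumFin-point r₀ _ λ r r≢r₀ →
                   if-does-no (e i₀ r ≟² (a , b)) λ eq → r≢r₀ (e-injective i₀ (trans eq (sym eq₀))))
                 (if-does-yes (e i₀ r₀ ≟² (a , b)) eq₀))

  -- h is the sum of the point masses f (e i r); exchange the order of summation.
  Σ²-image : (h f : Fin n → Fin n → ℕ) →
    (∀ a b → ∃₂ (λ i r → e i r ≡ (a , b)) → h a b ≡ f a b) →
    (∀ a b → ¬ ∃₂ (λ i r → e i r ≡ (a , b)) → h a b ≡ 0) →
    Σ² h ≡ sumFin (λ i → sumFin (λ r → uncurry f (e i r)))
  Σ²-image h f on off = begin
    Σ² h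
      ≡⟨ sumFin-cong (λ a → sumFin-cong (λ b → trans (h≡ a b) (sym (mass-total f a b)))) ⟩
    sumFin (λ a → sumFin λ b → sumFin λ i → sumFin λ r → mass i r f a b)
      ≡⟨ sumFin-cong (λ a → sumFin-comm (λ b i → sumFin λ r → mass i r f a b)) ⟩
    sumFin (λ a → sumFin λ i → sumFin λ b → sumFin λ r → mass i r f a b)
      ≡⟨ sumFin-cong (λ a → sumFin-cong (λ i → sumFin-comm (λ b r → mass i r f a b))) ⟩
    sumFin (λ a → sumFin λ i → sumFin λ r → sumFin λ b → mass i r f a b)
      ≡⟨ sumFin-comm (λ a i → sumFin λ r → sumFin λ b → mass i r f a b) ⟩
    sumFin (λ i → sumFin λ a → sumFin λ r → sumFin λ b → mass i r f a b)
      ≡⟨ sumFin-cong (λ i → sumFin-comm (λ a r → sumFin λ b → mass i r f a b)) ⟩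
    sumFin (λ i → sumFin λ r → Σ² (mass i r f))
      ≡⟨ sumFin-cong (λ i → sumFin-cong (λ r → Σ²-point (e i r) f)) ⟩
    sumFin (λ i → sumFin (λ r → uncurry f (e i r))) ∎
    where
    open ≡-Reasoning
    h≡ : ∀ a b → h a b ≡ (if does (hits? (a , b)) then f a b else 0)
    h≡ a b with hits? (a , b)
    ... | yes hits = on a b hits
    ... | no miss  = off a b miss

-- The edge {x, y} as the pair (min, max), the form in which len counts it.
orient : Fin n → Fin n → Fin n × Fin n
orient x y with toℕ x <? toℕ y
... | yes _ = x , y
... | no  _ = y , x

orient-cases : (x y : Fin n) →
  (orient x y ≡ (x , y) × toℕ x < toℕ y) ⊎ (orient x y ≡ (y , x) × ¬ toℕ x < toℕ y)
orient-cases x y with toℕ x <? toℕ y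
... | yes x<y = inj₁ (refl , x<y)
... | no  x≮y = inj₂ (refl , x≮y)

orient-≡ : {x y a b : Fin n} → orient x y ≡ (a , b) → (x ≡ a × y ≡ b) ⊎ (x ≡ b × y ≡ a)
orient-≡ {x = x} {y} eq with orient-cases x y
... | inj₁ (o≡xy , _) with trans (sym o≡xy) eq
...   | refl = inj₁ (refl , refl)
orient-≡ {x = x} {y} eq | inj₂ (o≡yx , _) with trans (sym o≡yx) eq
...   | refl = inj₂ (refl , refl)

orient-of-< : {x y a b : Fin n} → toℕ a < toℕ b → (x ≡ a × y ≡ b) ⊎ (x ≡ b × y ≡ a) → orient x y ≡ (a , b)
orient-of-< {x = x} {y} a<b (inj₁ (refl , refl)) with orient-cases x y
... | inj₁ (o≡xy , _)   = o≡xy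
... | inj₂ (_ , x≮y)    = ⊥-elim (x≮y a<b)
orient-of-< {x = x} {y} a<b (inj₂ (refl , refl)) with orient-cases x y
... | inj₁ (_ , x<y)    = ⊥-elim (<-asym a<b x<y)
... | inj₂ (o≡yx , _)   = o≡yx

orient-< : {x y a b : Fin n} → x ≢ y → orient x y ≡ (a , b) → toℕ a < toℕ b
orient-< {x = x} {y} x≢y eq with orient-cases x y
... | inj₁ (o≡xy , x<y) with trans (sym o≡xy) eq
...   | refl = x<y
orient-< {x = x} {y} x≢y eq | inj₂ (o≡yx , x≮y) with trans (sym o≡yx) eq
...   | refl = ≤∧≢⇒< (≮⇒≥ x≮y) (x≢y ∘ toℕ-injective ∘ sym)

orient-injective : {x y x′ y′ : Fin n} → orient x y ≡ orient x′ y′ →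
  (x ≡ x′ × y ≡ y′) ⊎ (x ≡ y′ × y ≡ x′)
orient-injective {x′ = x′} {y′} eq
  with orient-≡ {a = proj₁ (orient x′ y′)} {b = proj₂ (orient x′ y′)} eq
     | orient-≡ {x = x′} {y = y′} refl
... | inj₁ (x≡a , y≡b) | inj₁ (x′≡a , y′≡b) = inj₁ (trans x≡a (sym x′≡a) , trans y≡b (sym y′≡b))
... | inj₁ (x≡a , y≡b) | inj₂ (x′≡b , y′≡a) = inj₂ (trans x≡a (sym y′≡a) , trans y≡b (sym x′≡b))
... | inj₂ (x≡b , y≡a) | inj₁ (x′≡a , y′≡b) = inj₂ (trans x≡b (sym y′≡b) , trans y≡a (sym x′≡a))
... | inj₂ (x≡b , y≡a) | inj₂ (x′≡b , y′≡a) = inj₁ (trans x≡b (sym x′≡b) , trans y≡a (sym y′≡a))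

gap : Fin n → Fin n → ℕ
gap a b = toℕ b ∸ toℕ a

gap-orient : (x y : Fin n) → uncurry gap (orient x y) ≡ ∣ toℕ x - toℕ y ∣
gap-orient x y with orient-cases x y
... | inj₁ (o≡xy , x<y) = trans (cong (uncurry gap) o≡xy) (sym (m≤n⇒∣m-n∣≡n∸m (<⇒≤ x<y)))
... | inj₂ (o≡yx , x≮y) =
  trans (cong (uncurry gap) o≡yx) (sym (trans (∣-∣-comm (toℕ x) (toℕ y)) (m≤n⇒∣m-n∣≡n∸m (≮⇒≥ x≮y))))

∣m-n∣+m≡n+2[m∸n] : ∀ m n → ∣ m - n ∣ + m ≡ n + 2 * (m ∸ n)
∣m-n∣+m≡n+2[m∸n] m n with ≤-total m n
... | inj₁ m≤n = begin
  ∣ m - n ∣ + m      ≡⟨ cong (_+ m) (m≤n⇒∣m-n∣≡n∸m m≤n) ⟩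
  n ∸ m + m          ≡⟨ m∸n+n≡m m≤n ⟩
  n                  ≡⟨ sym (+-identityʳ n) ⟩
  n + 2 * 0          ≡⟨ cong (λ d → n + 2 * d) (sym (m≤n⇒m∸n≡0 m≤n)) ⟩
  n + 2 * (m ∸ n)    ∎
  where open ≡-Reasoning
... | inj₂ n≤m = begin
  ∣ m - n ∣ + m              ≡⟨ cong (_+ m) (trans (∣-∣-comm m n) (m≤n⇒∣m-n∣≡n∸m n≤m)) ⟩
  (m ∸ n) + m                ≡⟨ cong ((m ∸ n) +_) (sym (m∸n+n≡m n≤m)) ⟩
  (m ∸ n) + ((m ∸ n) + n)    ≡⟨ solve 2 (λ d n → d :+ (d :+ n) := n :+ con 2 :* d) refl (m ∸ n) n ⟩
  n + 2 * (m ∸ n)            ∎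
  where open ≡-Reasoning

telescope : ∀ L (u : Fin (suc L) → ℕ) (d c : Fin L → ℕ) →
  (∀ r → d r + u (inject₁ r) ≡ u (suc r) + c r) →
  sumFin d + u zero ≡ u (fromℕ L) + sumFin c
telescope zero    u d c step = sym (+-identityʳ (u zero))
telescope (suc L) u d c step = begin
  (d zero + D) + u zero        ≡⟨ cong (_+ u zero) (+-comm (d zero) D) ⟩
  (D + d zero) + u zero        ≡⟨ +-assoc D (d zero) (u zero) ⟩
  D + (d zero + u zero)        ≡⟨ cong (D +_) (step zero) ⟩
  D + (u (suc zero) + c zero)  ≡⟨ sym (+-assoc D (u (suc zero)) (c zero)) ⟩
  (D + u (suc zero)) + c zero  ≡⟨ cong (_+ c zero) (telescope L (u ∘ suc) (d ∘ suc) (c ∘ suc) (step ∘ suc)) ⟩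
  (u′ + C) + c zero            ≡⟨ +-assoc u′ C (c zero) ⟩
  u′ + (C + c zero)            ≡⟨ cong (u′ +_) (+-comm C (c zero)) ⟩
  u′ + (c zero + C)            ∎
  where
  open ≡-Reasoning
  D C u′ : ℕ
  D  = sumFin (d ∘ suc)
  C  = sumFin (c ∘ suc)
  u′ = u (fromℕ (suc L))

lenWeight : (Fin n → Fin n → Bool) → Fin n → Fin n → ℕ
lenWeight Q a b = if Q a b ∧ (toℕ a <ᵇ toℕ b) then gap a b else 0

lenWeight-on : ∀ (Q : Fin n → Fin n → Bool) {a b} →
  Q a b ≡ true → toℕ a < toℕ b → lenWeight Q a b ≡ gap a b
lenWeight-on Q Qab a<b rewrite Qab | Equivalence.to T-≡ (<⇒<ᵇ a<b) = refl

lenWeight-off : ∀ (Q : Fin n → Fin n → Bool) {a b} →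
  ¬ (Q a b ≡ true × toℕ a < toℕ b) → lenWeight Q a b ≡ 0
lenWeight-off Q {a} {b} ¬on with Q a b | toℕ a <ᵇ toℕ b in a<ᵇb
... | true  | true  = ⊥-elim (¬on (refl , <ᵇ⇒< _ _ (Equivalence.from T-≡ a<ᵇb)))
... | true  | false = refl
... | false | _     = refl

inject₁≢suc : ∀ {m} (r : Fin m) → inject₁ r ≢ suc r
inject₁≢suc r eq = 1+n≢n (sym (trans (sym (toℕ-inject₁ r)) (cong toℕ eq)))

inject₁≡suc⇒suc≢inject₁ : ∀ {m} {r s : Fin m} → inject₁ r ≡ suc s → suc r ≢ inject₁ s
inject₁≡suc⇒suc≢inject₁ {r = r} {s} r≡s+1 r+1≡s =
  <-asym (≤-reflexive (sym (trans (sym (toℕ-inject₁ r)) (cong toℕ r≡s+1))))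
         (≤-reflexive (trans (cong toℕ r+1≡s) (toℕ-inject₁ s)))

module _ {R : Rel n} {S T : Fin k → Fin n} (ps : PathSystem R S T) where

  stepFrom stepTo : (i : Fin k) → Fin (len′ ps i) → Fin n
  stepFrom i r = w ps i (inject₁ r)
  stepTo   i r = w ps i (suc r)

  edge : (i : Fin k) → Fin (len′ ps i) → Fin n × Fin n
  edge i r = orient (stepFrom i r) (stepTo i r)

  -- Only steps going backwards in the ordering contribute (truncated subtraction).
  excess : ℕ
  excess = sumFin λ i → sumFin λ r → 2 * (toℕ (stepFrom i r) ∸ toℕ (stepTo i r))

  withSteps : ∀ {R′ : Rel n} → (∀ i r → R′ (stepFrom i r) (stepTo i r)) → PathSystem R′ S T
  withSteps step′ = record
    { σ = σ ps ; len′ = len′ ps ; w = w ps ; simple = simple ps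
    ; start = start ps ; end = end ps ; step = step′ ; disj = disj ps }

  stepFrom≢stepTo : ∀ i r → stepFrom i r ≢ stepTo i r
  stepFrom≢stepTo i r eq = inject₁≢suc r (simple ps i eq)

  edge-injective : ∀ i → Injective _≡_ _≡_ (edge i)
  edge-injective i {r} {s} eq with orient-injective eq
  ... | inj₁ (from≡from , _)    = inject₁-injective (simple ps i from≡from)
  ... | inj₂ (from≡to , to≡from) =
    ⊥-elim (inject₁≡suc⇒suc≢inject₁ (simple ps i from≡to) (simple ps i to≡from))

  edge-disjoint : ∀ i j r s → edge i r ≡ edge j s → i ≡ j
  edge-disjoint i j r s eq with i ≟ᶠ j
  ... | yes i≡j = i≡j
  ... | no  i≢j with orient-injective eq
  ...   | inj₁ (from≡from , _) = ⊥-elim (disj ps i j i≢j _ _ from≡from)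
  ...   | inj₂ (from≡to , _)   = ⊥-elim (disj ps i j i≢j _ _ from≡to)

  len-edges : (Q : Fin n → Fin n → Bool) → (∀ a b → (Q a b ≡ true) ⇔ UEdges ps a b) →
    len Q ≡ sumFin λ i → sumFin λ r → ∣ toℕ (stepFrom i r) - toℕ (stepTo i r) ∣
  len-edges Q Q≡ps =
    trans (Σ²-image edge edge-injective edge-disjoint (lenWeight Q) gap on off)
          (sumFin-cong λ i → sumFin-cong λ r → gap-orient (stepFrom i r) (stepTo i r))
    where
    on : ∀ a b → ∃₂ (λ i r → edge i r ≡ (a , b)) → lenWeight Q a b ≡ gap a b
    on a b (i , r , eq) = lenWeight-on Q (proj₂ (Q≡ps a b) joins) (orient-< (stepFrom≢stepTo i r) eq)
      where
      joins : UEdges ps a b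
      joins with orient-≡ eq
      ... | inj₁ forwards  = inj₁ (i , r , forwards)
      ... | inj₂ backwards = inj₂ (i , r , backwards)
    off : ∀ a b → ¬ ∃₂ (λ i r → edge i r ≡ (a , b)) → lenWeight Q a b ≡ 0
    off a b miss = lenWeight-off Q λ { (Qab , a<b) → miss (joins⇒edge a<b (proj₁ (Q≡ps a b) Qab)) }
      where
      joins⇒edge : toℕ a < toℕ b → UEdges ps a b → ∃₂ (λ i r → edge i r ≡ (a , b))
      joins⇒edge a<b (inj₁ (i , r , forwards))  = i , r , orient-of-< a<b (inj₁ forwards)
      joins⇒edge a<b (inj₂ (i , r , backwards)) = i , r , orient-of-< a<b (inj₂ backwards)

  len-identity : (Q : Fin n → Fin n → Bool) → (∀ a b → (Q a b ≡ true) ⇔ UEdges ps a b) →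
    len Q + sumFin (toℕ ∘ S) ≡ sumFin (toℕ ∘ T) + excess
  len-identity Q Q≡ps = begin
    len Q + sumFin (toℕ ∘ S)                     ≡⟨ cong (_+ sumFin (toℕ ∘ S)) (len-edges Q Q≡ps) ⟩
    sumFin (sumFin ∘ dist) + sumFin (toℕ ∘ S)    ≡⟨ sym (sumFin-distrib-+ (sumFin ∘ dist) (toℕ ∘ S)) ⟩
    sumFin (λ i → sumFin (dist i) + toℕ (S i))   ≡⟨ sumFin-cong path-identity ⟩
    sumFin (λ i → toℕ (T (σ ps ⟨$⟩ʳ i)) + sumFin (back i))
      ≡⟨ sumFin-distrib-+ (toℕ ∘ T ∘ (σ ps ⟨$⟩ʳ_)) (sumFin ∘ back) ⟩
    sumFin (toℕ ∘ T ∘ (σ ps ⟨$⟩ʳ_)) + excess     ≡⟨ cong (_+ excess) (sumFin-permute (toℕ ∘ T) (σ ps)) ⟩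
    sumFin (toℕ ∘ T) + excess                    ∎
    where
    open ≡-Reasoning
    dist back : (i : Fin k) → Fin (len′ ps i) → ℕ
    dist i r = ∣ toℕ (stepFrom i r) - toℕ (stepTo i r) ∣
    back i r = 2 * (toℕ (stepFrom i r) ∸ toℕ (stepTo i r))
    path-identity : ∀ i → sumFin (dist i) + toℕ (S i) ≡ toℕ (T (σ ps ⟨$⟩ʳ i)) + sumFin (back i)
    path-identity i =
      subst₂ (λ s t → sumFin (dist i) + toℕ s ≡ toℕ t + sumFin (back i)) (start ps i) (end ps i)
        (telescope (len′ ps i) (toℕ ∘ w ps i) (dist i) (back i)
           λ r → ∣m-n∣+m≡n+2[m∸n] (toℕ (stepFrom i r)) (toℕ (stepTo i r)))

  excess≡0⇒forward : excess ≡ 0 → ∀ i r → toℕ (stepFrom i r) < toℕ (stepTo i r)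
  excess≡0⇒forward excess≡0 i r =
    ≤∧≢⇒< (m∸n≡0⇒m≤n back≡0) (stepFrom≢stepTo i r ∘ toℕ-injective)
    where
    back≡0 : toℕ (stepFrom i r) ∸ toℕ (stepTo i r) ≡ 0
    back≡0 = m+n≡0⇒m≡0 _ (sumFin≡0⇒≡0 _ (sumFin≡0⇒≡0 _ excess≡0 i) r)

  forward⇒excess≡0 : (∀ i r → toℕ (stepFrom i r) < toℕ (stepTo i r)) → excess ≡ 0
  forward⇒excess≡0 forward =
    sumFin-zero λ i → sumFin-zero λ r → cong (2 *_) (m≤n⇒m∸n≡0 (<⇒≤ (forward i r)))

UEdges? : ∀ {R : Rel n} {S T : Fin k → Fin n} (ps : PathSystem R S T) a b → Dec (UEdges ps a b)
UEdges? ps a b = Consec? a b ⊎-dec Consec? b a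
  where
  Consec? : ∀ a b → Dec (Consec ps a b)
  Consec? a b = any? λ i → any? λ r → (w ps i (inject₁ r) ≟ᶠ a) ×-dec (w ps i (suc r) ≟ᶠ b)

does≡true⇔ : ∀ {X : Set} (d : Dec X) → (does d ≡ true) ⇔ X
does≡true⇔ (yes x) = (λ _ → x) , (λ _ → refl)
does≡true⇔ (no ¬x) = (λ ()) , (⊥-elim ∘ ¬x)

edgeSet : ∀ {R : Rel n} {S T : Fin k → Fin n} → PathSystem R S T → Fin n → Fin n → Bool
edgeSet ps a b = does (UEdges? ps a b)

edgeSet-spec : ∀ {R : Rel n} {S T : Fin k → Fin n} (ps : PathSystem R S T) a b →
  (edgeSet ps a b ≡ true) ⇔ UEdges ps a b
edgeSet-spec ps a b = does≡true⇔ (UEdges? ps a b)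

arcs⇒edges : ∀ {R A : Rel n} {S T : Fin k → Fin n} (P : Fin n → Fin n → Bool) (ps : PathSystem R S T) →
  (∀ a b → P a b ≡ P b a) → (∀ a b → P a b ≡ true → Und A a b) →
  (∀ a b → Arcs A P a b ⇔ Consec ps a b) → ∀ a b → (P a b ≡ true) ⇔ UEdges ps a b
arcs⇒edges P ps P-sym P⊆E arcs≡ps a b = edge⇒consec , consec⇒edge
  where
  edge⇒consec : P a b ≡ true → UEdges ps a b
  edge⇒consec Pab with P⊆E a b Pab
  ... | inj₁ Aab = inj₁ (proj₁ (arcs≡ps a b) (Aab , Pab))
  ... | inj₂ Aba = inj₂ (proj₁ (arcs≡ps b a) (Aba , trans (P-sym b a) Pab))
  consec⇒edge : UEdges ps a b → P a b ≡ true
  consec⇒edge (inj₁ ab) = proj₂ (proj₂ (arcs≡ps a b) ab)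
  consec⇒edge (inj₂ ba) = trans (P-sym a b) (proj₂ (proj₂ (arcs≡ps b a) ba))

module _ {A : Rel n} (acyclic : ∀ i j → A i j → toℕ i < toℕ j) where

  forward-edge⇒arc : ∀ {x y} → toℕ x < toℕ y → Und A x y → A x y
  forward-edge⇒arc x<y (inj₁ Axy) = Axy
  forward-edge⇒arc x<y (inj₂ Ayx) = ⊥-elim (<-asym x<y (acyclic _ _ Ayx))

  module _ {S T : Fin k → Fin n} where

    undirected : PathSystem A S T → PathSystem (Und A) S T
    undirected ps = withSteps ps λ i r → inj₁ (step ps i r)

    edges⇒arcs : (P : Fin n → Fin n → Bool) (ps : PathSystem A S T) →
      (∀ a b → (P a b ≡ true) ⇔ UEdges ps a b) → ∀ a b → Arcs A P a b ⇔ Consec ps a b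
    edges⇒arcs P ps P≡ps a b = arc⇒consec , consec⇒arc
      where
      arc⇒consec : Arcs A P a b → Consec ps a b
      arc⇒consec (Aab , Pab) with proj₁ (P≡ps a b) Pab
      ... | inj₁ ab = ab
      ... | inj₂ (i , r , from≡b , to≡a) =
        ⊥-elim (<-asym (acyclic a b Aab) (acyclic b a (subst₂ A from≡b to≡a (step ps i r))))
      consec⇒arc : Consec ps a b → Arcs A P a b
      consec⇒arc ab@(i , r , from≡a , to≡b) = subst₂ A from≡a to≡b (step ps i r) , proj₂ (P≡ps a b) (inj₁ ab)

    len-lower-bound : ∀ Q → IsDisjPath A S T Q → sumFin (toℕ ∘ T) ≤ len Q + sumFin (toℕ ∘ S)
    len-lower-bound Q (ps , Q≡ps) rewrite len-identity ps Q Q≡ps = m≤m+n _ _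

    len-directed : (ps : PathSystem A S T) (Q : Fin n → Fin n → Bool) →
      (∀ a b → (Q a b ≡ true) ⇔ UEdges ps a b) → len Q + sumFin (toℕ ∘ S) ≡ sumFin (toℕ ∘ T)
    len-directed ps Q Q≡ps = begin
      len Q + sumFin (toℕ ∘ S)         ≡⟨ len-identity (undirected ps) Q Q≡ps ⟩
      sumFin (toℕ ∘ T) + excess ps     ≡⟨ cong (sumFin (toℕ ∘ T) +_) (forward⇒excess≡0 ps λ i r → acyclic _ _ (step ps i r)) ⟩
      sumFin (toℕ ∘ T) + 0             ≡⟨ +-identityʳ _ ⟩
      sumFin (toℕ ∘ T)                 ∎
      where open ≡-Reasoning

    shortest⇒excess≡0 : (D : PathSystem A S T) (P : Fin n → Fin n → Bool) →
      IsShortestDisjPath A S T P → (ps : PathSystem (Und A) S T) →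
      (∀ a b → (P a b ≡ true) ⇔ UEdges ps a b) → excess ps ≡ 0
    shortest⇒excess≡0 D P (_ , minimal) ps P≡ps = n≤0⇒n≡0 (+-cancelˡ-≤ (sumFin (toℕ ∘ T)) _ _ (begin
      sumFin (toℕ ∘ T) + excess ps            ≡⟨ sym (len-identity ps P P≡ps) ⟩
      len P + sumFin (toℕ ∘ S)                ≤⟨ +-monoˡ-≤ _ (minimal (edgeSet D) (undirected D , edgeSet-spec D)) ⟩
      len (edgeSet D) + sumFin (toℕ ∘ S)      ≡⟨ len-directed D (edgeSet D) (edgeSet-spec D) ⟩
      sumFin (toℕ ∘ T)                        ≡⟨ sym (+-identityʳ _) ⟩
      sumFin (toℕ ∘ T) + 0                    ∎))
      where open Data.Nat.Properties.≤-Reasoning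

proposition4p5 :
    (n k : ℕ) (A : Rel n)
    → (∀ i j → A i j → toℕ i < toℕ j)
    → (S T : Fin k → Fin n)
    → Injective _≡_ _≡_ S → Injective _≡_ _≡_ T
    → (∀ i j → S i ≢ T j)
    → Σ (Rel n) (IsDisjDirPath A S T)
    → (P : Fin n → Fin n → Bool)
    → (∀ a b → P a b ≡ P b a)
    → (∀ a b → P a b ≡ true → Und A a b)
    → IsShortestDisjPath A S T P ⇔ IsDisjDirPath A S T (Arcs A P)
proposition4p5 n k A acyclic S T _ _ _ (_ , D , _) P P-sym P⊆E = shortest⇒directed , directed⇒shortest
  where
  shortest⇒directed : IsShortestDisjPath A S T P → IsDisjDirPath A S T (Arcs A P)
  shortest⇒directed shortest@((ps , P≡ps) , _) = withSteps ps arc , edges⇒arcs acyclic P (withSteps ps arc) P≡ps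
    where
    arc : ∀ i r → A (stepFrom ps i r) (stepTo ps i r)
    arc i r = forward-edge⇒arc acyclic
      (excess≡0⇒forward ps (shortest⇒excess≡0 acyclic D P shortest ps P≡ps) i r) (step ps i r)

  directed⇒shortest : IsDisjDirPath A S T (Arcs A P) → IsShortestDisjPath A S T P
  directed⇒shortest (ps , arcs≡ps) = (undirected acyclic ps , P≡ps) , λ Q Q-path →
    +-cancelʳ-≤ _ (len P) (len Q)
      (subst (_≤ len Q + _) (sym (len-directed acyclic ps P P≡ps)) (len-lower-bound acyclic Q Q-path))
    where
    P≡ps : ∀ a b → (P a b ≡ true) ⇔ UEdges ps a b
    P≡ps = arcs⇒edges P ps P-sym P⊆E arcs≡ps
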